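{- Let $m = p_1^{e_1}\cdots p_r^{e_r}$, $R=\{1,\dots,r\}$, $\emptyset \neq I \subsetneq R$, $U = (\mathbb{Z}/m\mathbb{Z})^\times$, and let $C_I$ be the connected component of the sequential power graph of $\mathbb{Z}/m\mathbb{Z}$ containing $d_I$. Then the sets $y\pi_I U = \{y\pi_I u \bmod m : u\in U\}$, where $y$ ranges over the positive divisors of $g_I/\pi_I$ with $y\neq g_I/\pi_I$, partition the set of tails of $C_I$.
   Context: $m = p_1^{e_1}\cdots p_r^{e_r}$ with distinct primes, $e_i\ge1$. For $I\subseteq R$: $\pi_I=\prod_{i\in I}p_i$, $g_I = \prod_{i\in I} p_i^{e_i}$, and $d_I$ is the idempotent with $d_I\equiv 0\pmod{p_i^{e_i}}$ for $i\in I$, $d_I\equiv1\pmod{p_j^{e_j}}$ for $j\notin I$. The sequential power graph of $\mathbb{Z}/m\mathbb{Z}$ is the directed graph on $\mathbb{Z}/m\mathbb{Z}$ with an edge $(b,c)$ iff $b\equiv a^i$, $c\equiv a^{i+1}\pmod m$ for some $a$ and $i\in\mathbb{N}$; connected components are with respect to undirected paths. An element $v$ is a tail if $v^{k+1}\not\equiv v\pmod m$ for all $k\ge1$. -}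

module Defs where

open import Data.Nat using (ℕ; zero; suc; _*_; _^_; _≤_; _<_)
open import Data.Bool using (Bool; true; false; if_then_else_)
open import Data.Fin using (Fin)
import Data.Fin as F
open import Data.Fin.Subset using (Subset; _∈_; _∉_)
open import Data.Vec using (lookup)
open import Data.Integer using (ℤ; +_; _-_)
open import Data.Integer.Divisibility using () renaming (_∣_ to _∣ℤ_)
open import Data.Nat.Coprimality using (Coprime)
open import Data.Product using (Σ; ∃; _×_; _,_)
open import Relation.Nullary using (¬_)

prodFin : ∀ {r} → (Fin r → ℕ) → ℕ
prodFin {zero}  f = 1
prodFin {suc r} f = f F.zero * prodFin (λ i → f (F.suc i))

_≡_[mod_] : ℕ → ℕ → ℕ → Set
a ≡ b [mod n ] = (+ n) ∣ℤ ((+ a) - (+ b))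

gI : ∀ {r} → (Fin r → ℕ) → (Fin r → ℕ) → Subset r → ℕ
gI p e I = prodFin (λ i → if lookup I i then p i ^ e i else 1)

πI : ∀ {r} → (Fin r → ℕ) → Subset r → ℕ
πI p I = prodFin (λ i → if lookup I i then p i else 1)

-- g_I / π_I = ∏_{i∈I} p_i^{e_i - 1}  (e_i ≥ 1, so this is the exact quotient)
gOverπ : ∀ {r} → (Fin r → ℕ) → (Fin r → ℕ) → Subset r → ℕ
gOverπ p e I = prodFin (λ i → if lookup I i then p i ^ (e i Data.Nat.∸ 1) else 1)

-- the idempotent d_I (characterised by its CRT congruences; unique below m)
IsDI : ∀ {r} → ℕ → (Fin r → ℕ) → (Fin r → ℕ) → Subset r → ℕ → Set
IsDI m p e I d =
  d < m × (∀ i → (i ∈ I → d ≡ 0 [mod (p i ^ e i) ]) × (i ∉ I → d ≡ 1 [mod (p i ^ e i) ]))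

-- edge (b,c) of the sequential power graph of ℤ/mℤ (residues represented by 0..m-1);
-- i ranges over positive integers
Edge : ℕ → ℕ → ℕ → Set
Edge m b c = b < m × c < m ×
  Σ ℕ (λ a → Σ ℕ (λ i → 1 ≤ i × (b ≡ (a ^ i) [mod m ]) × (c ≡ (a ^ suc i) [mod m ])))

data Connected (m : ℕ) : ℕ → ℕ → Set where
  here : ∀ {x} → x < m → Connected m x x
  fwd  : ∀ {x y z} → Edge m x y → Connected m y z → Connected m x z
  bwd  : ∀ {x y z} → Edge m y x → Connected m y z → Connected m x z

IsTail : ℕ → ℕ → Set
IsTail m v = ∀ k → 1 ≤ k → ¬ ((v ^ suc k) ≡ v [mod m ])

InCoset : ℕ → ℕ → ℕ → ℕ → Set
InCoset m y π v = v < m × ∃ (λ u → u < m × Coprime u m × (v ≡ (y * π * u) [mod m ]))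

module Submission where

open import Defs
open import Data.Nat using (ℕ; _^_; _≤_; _<_)
open import Data.Nat.Primality using (Prime)
open import Data.Nat.Divisibility using (_∣_)
open import Data.Fin using (Fin)
open import Data.Fin.Subset using (Subset; _∈_; _∉_)
open import Data.Product using (Σ; ∃; _×_; _,_)
open import Relation.Binary.PropositionalEquality using (_≡_; _≢_)
open import Relation.Nullary using (¬_)
open import Function.Definitions using (Injective)

open import Data.Nat
open import Data.Nat.Properties
open import Data.Nat.Divisibility
open import Data.Nat.DivMod using (_%_; _/_; m%n<n; m≡m%n+[m/n]*n; m<n⇒m%n≡m; m*[n/m]≡n; m/n*n≡m)
open import Data.Nat.GCD using (gcd; gcd[m,n]∣m; gcd[m,n]∣n; gcd-greatest; gcd[m,n]≢0)
open import Data.Nat.Coprimality as Coprimality using (Coprime; coprime-divisor; 1-coprimeTo; coprime-/gcd)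
open import Data.Nat.Primality
open import Data.Nat.Tactic.RingSolver using (solve-∀)
import Data.Fin as F
open import Data.Fin.Properties using (pigeonhole; toℕ-fromℕ<) renaming (suc-injective to fsuc-injective)
open import Data.Vec using (lookup)
open import Data.Vec.Properties using ([]=⇒lookup; lookup⇒[]=)
open import Data.Bool using (true; false; if_then_else_)
open import Data.Product using (proj₁; proj₂)
open import Data.Sum using (inj₁; inj₂)
open import Data.Empty using (⊥-elim)
open import Relation.Binary.PropositionalEquality
open import Relation.Nullary using (yes; no)
import Data.Integer as ℤ
import Data.Integer.Properties as ℤP
import Data.Integer.Divisibility.Signed as ℤ∣
open import Data.Integer.Tactic.RingSolver using () renaming (solve-∀ to ℤ-solve-∀)

-- Write m = G H with G = g_I and H = ∏_{j∉I} p_j^{e_j} (coprime), π = π_I and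
-- h = g_I / π_I, so G = π h. The proof rests on three observations.
--  * Along an edge both ends are powers a^i, a^(i+1) with i ≥ 1, so a prime divisor
--    of m divides both or neither. Hence every v in the component of d is a multiple
--    of π and a unit modulo H.
--  * Conversely, any v with π ∣ v that is a unit modulo H is joined to d: some power
--    v^M is ≡ 0 mod G and ≡ 1 mod H, i.e. ≡ d, and v is joined to all its powers.
--  * Such a v is a tail iff G ∤ v: if G ∣ v then v^(K+1) ≡ v for the order K of v mod H;
--    if v^(k+1) ≡ v then v ≡ v^(Nk+1) is divisible by G.
-- For a tail v, w = gcd(v, G) = y π with y a proper divisor of h, and v = w u for a
-- unit u (v / w is coprime to m / w, and can be shifted by multiples of m / w to avoid
-- every prime). Two cosets y π U, y′ π U meeting in v have y π ∣ y′ π ∣ y π.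

-- Primes, coprimality and divisibility of powers

coprime-∣ˡ : ∀ {k a b} → k ∣ a → Coprime a b → Coprime k b
coprime-∣ˡ k∣a a⊥b (d∣k , d∣b) = a⊥b (∣-trans d∣k k∣a , d∣b)

coprime-*ʳ : ∀ {a b c} → Coprime a b → Coprime a c → Coprime a (b * c)
coprime-*ʳ a⊥b a⊥c (d∣a , d∣bc) = a⊥c (d∣a , coprime-divisor (coprime-∣ˡ d∣a a⊥b) d∣bc)

coprime-^ˡ : ∀ {a n} k → Coprime a n → Coprime (a ^ k) n
coprime-^ˡ zero    a⊥n = 1-coprimeTo _
coprime-^ˡ (suc k) a⊥n =
  Coprimality.sym (coprime-*ʳ (Coprimality.sym a⊥n) (Coprimality.sym (coprime-^ˡ k a⊥n)))

coprime-∣-* : ∀ {g h x} → Coprime g h → g ∣ x → h ∣ x → g * h ∣ x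
coprime-∣-* {g} {h} g⊥h (divides q refl) h∣qg =
  subst (g * h ∣_) (*-comm g q)
    (*-monoʳ-∣ g (coprime-divisor (Coprimality.sym g⊥h) (subst (h ∣_) (*-comm q g) h∣qg)))

prime>1 : ∀ {p} → Prime p → 1 < p
prime>1 {p} p-prime = nonTrivial⇒n>1 p {{prime⇒nonTrivial p-prime}}

prime∤1 : ∀ {p} → Prime p → ¬ p ∣ 1
prime∤1 p-prime p∣1 = <⇒≢ (prime>1 p-prime) (sym (∣1⇒≡1 p∣1))

prime-coprime : ∀ {p a} → Prime p → ¬ p ∣ a → Coprime p a
prime-coprime p-prime p∤a (d∣p , d∣a) with prime⇒irreducible p-prime d∣p
... | inj₁ d≡1    = d≡1
... | inj₂ refl = ⊥-elim (p∤a d∣a)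

prime-∣-^ : ∀ {p a} n → Prime p → p ∣ a ^ n → p ∣ a
prime-∣-^ zero    p-prime p∣1 = ⊥-elim (prime∤1 p-prime p∣1)
prime-∣-^ {a = a} (suc n) p-prime p∣aⁿ⁺¹ with euclidsLemma a (a ^ n) p-prime p∣aⁿ⁺¹
... | inj₁ p∣a  = p∣a
... | inj₂ p∣aⁿ = prime-∣-^ n p-prime p∣aⁿ

prime-∣-prime : ∀ {p q} → Prime p → Prime q → p ∣ q → p ≡ q
prime-∣-prime p-prime q-prime p∣q with prime⇒irreducible q-prime p∣q
... | inj₁ refl = ⊥-elim (prime∤1 p-prime ∣-refl)
... | inj₂ p≡q  = p≡q

distinct-prime-powers-coprime : ∀ {p q} a b → Prime p → Prime q → p ≢ q → Coprime (p ^ a) (q ^ b)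
distinct-prime-powers-coprime {p} {q} a b p-prime q-prime p≢q =
  coprime-^ˡ a (Coprimality.sym (coprime-^ˡ b (prime-coprime q-prime q∤p)))
  where
  q∤p : ¬ q ∣ p
  q∤p = λ q∣p → p≢q (sym (prime-∣-prime q-prime p-prime q∣p))

^-∣-^ʳ : ∀ a {n₁ n₂} → n₁ ≤ n₂ → a ^ n₁ ∣ a ^ n₂
^-∣-^ʳ a {n₁} {n₂} n₁≤n₂ = divides (a ^ (n₂ ∸ n₁)) (begin
  a ^ n₂                 ≡⟨ cong (a ^_) (m+[n∸m]≡n n₁≤n₂) ⟨
  a ^ (n₁ + (n₂ ∸ n₁))   ≡⟨ ^-distribˡ-+-* a n₁ (n₂ ∸ n₁) ⟩
  a ^ n₁ * a ^ (n₂ ∸ n₁) ≡⟨ *-comm (a ^ n₁) _ ⟩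
  a ^ (n₂ ∸ n₁) * a ^ n₁ ∎)
  where open ≡-Reasoning

^-∣-^ˡ : ∀ {a b} n → a ∣ b → a ^ n ∣ b ^ n
^-∣-^ˡ zero    a∣b = ∣-refl
^-∣-^ˡ (suc n) a∣b = *-pres-∣ a∣b (^-∣-^ˡ n a∣b)

prod-cong : ∀ {r} {f g : Fin r → ℕ} → (∀ i → f i ≡ g i) → prodFin f ≡ prodFin g
prod-cong {zero}  f≗g = refl
prod-cong {suc r} f≗g = cong₂ _*_ (f≗g F.zero) (prod-cong (λ i → f≗g (F.suc i)))

prod-* : ∀ {r} (f g : Fin r → ℕ) → prodFin (λ i → f i * g i) ≡ prodFin f * prodFin g
prod-* {zero}  f g = refl
prod-* {suc r} f g =
  trans (cong (f F.zero * g F.zero *_) (prod-* (λ i → f (F.suc i)) (λ i → g (F.suc i))))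
        (interchange (f F.zero) (g F.zero) (prodFin (λ i → f (F.suc i))) (prodFin (λ i → g (F.suc i))))
  where
  interchange : ∀ a b c d → a * b * (c * d) ≡ a * c * (b * d)
  interchange = solve-∀

factor-∣-prod : ∀ {r} (f : Fin r → ℕ) i → f i ∣ prodFin f
factor-∣-prod f F.zero    = m∣m*n _
factor-∣-prod f (F.suc i) = ∣n⇒∣m*n (f F.zero) (factor-∣-prod (λ j → f (F.suc j)) i)

prod>0 : ∀ {r} (f : Fin r → ℕ) → (∀ i → 0 < f i) → 0 < prodFin f
prod>0 {zero}  f f>0 = z<s
prod>0 {suc r} f f>0 = *-mono-< (f>0 F.zero) (prod>0 (λ i → f (F.suc i)) (λ i → f>0 (F.suc i)))

coprime-prod : ∀ {r a} (f : Fin r → ℕ) → (∀ i → Coprime a (f i)) → Coprime a (prodFin f)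
coprime-prod {zero}  f a⊥f = Coprimality.sym (1-coprimeTo _)
coprime-prod {suc r} f a⊥f = coprime-*ʳ (a⊥f F.zero) (coprime-prod (λ i → f (F.suc i)) (λ i → a⊥f (F.suc i)))

prod-coprime-prod : ∀ {r} (f g : Fin r → ℕ) → (∀ i j → Coprime (f i) (g j)) → Coprime (prodFin f) (prodFin g)
prod-coprime-prod f g f⊥g =
  coprime-prod g (λ j → Coprimality.sym (coprime-prod f (λ i → Coprimality.sym (f⊥g i j))))

pairwise-coprime-prod-∣ : ∀ {r x} (f : Fin r → ℕ) → (∀ i j → i ≢ j → Coprime (f i) (f j)) →
                          (∀ i → f i ∣ x) → prodFin f ∣ x
pairwise-coprime-prod-∣ {zero}  f f-coprime f∣x = 1∣ _
pairwise-coprime-prod-∣ {suc r} f f-coprime f∣x =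
  coprime-∣-* (coprime-prod (λ i → f (F.suc i)) (λ i → f-coprime F.zero (F.suc i) (λ ())))
    (f∣x F.zero)
    (pairwise-coprime-prod-∣ (λ i → f (F.suc i))
      (λ i j i≢j → f-coprime (F.suc i) (F.suc j) (λ si≡sj → i≢j (fsuc-injective si≡sj)))
      (λ i → f∣x (F.suc i)))

prime-∣-prod : ∀ {r q} (f : Fin r → ℕ) → Prime q → q ∣ prodFin f → ∃ λ i → q ∣ f i
prime-∣-prod {zero}  f q-prime q∣1 = ⊥-elim (prime∤1 q-prime q∣1)
prime-∣-prod {suc r} f q-prime q∣prod
  with euclidsLemma (f F.zero) (prodFin (λ i → f (F.suc i))) q-prime q∣prod
... | inj₁ q∣f₀   = F.zero , q∣f₀
... | inj₂ q∣rest = let (i , q∣fᵢ) = prime-∣-prod (λ i → f (F.suc i)) q-prime q∣rest in F.suc i , q∣fᵢ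

-- Congruences
--
-- It carries the same information as
-- a ≡ b [mod n ] from Defs, but as a record type it determines a, b and n, so
-- Agda can infer them when congruences are chained.

infix 4 _≈_⟨mod_⟩
record _≈_⟨mod_⟩ (a b n : ℕ) : Set where
  constructor mk≈
  field n∣a-b : ℤ.+ n ℤ∣.∣ (ℤ.+ a ℤ.- ℤ.+ b)

≈⇒≡[mod] : ∀ {a b n} → a ≈ b ⟨mod n ⟩ → a ≡ b [mod n ]
≈⇒≡[mod] (mk≈ n∣a-b) = ℤ∣.∣⇒∣ᵤ n∣a-b

≡[mod]⇒≈ : ∀ {a b n} → a ≡ b [mod n ] → a ≈ b ⟨mod n ⟩
≡[mod]⇒≈ n∣a-b = mk≈ (ℤ∣.∣ᵤ⇒∣ n∣a-b)

-- Every congruence below comes from n dividing an integer expression that is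
-- a - b up to ring normalisation.
≈-from : ∀ {a b n} {x : ℤ.ℤ} → ℤ.+ n ℤ∣.∣ x → x ≡ ℤ.+ a ℤ.- ℤ.+ b → a ≈ b ⟨mod n ⟩
≈-from n∣x refl = mk≈ n∣x

≈-refl : ∀ {n} a → a ≈ a ⟨mod n ⟩
≈-refl {n} a = ≈-from (ℤ∣.∣ᵤ⇒∣ (n ∣0)) (sym (ℤP.+-inverseʳ (ℤ.+ a)))

≈-sym : ∀ {a b n} → a ≈ b ⟨mod n ⟩ → b ≈ a ⟨mod n ⟩
≈-sym {a} {b} (mk≈ n∣a-b) = ≈-from (ℤ∣.∣m⇒∣-m n∣a-b) (negate (ℤ.+ a) (ℤ.+ b))
  where
  negate : ∀ x y → ℤ.- (x ℤ.- y) ≡ y ℤ.- x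
  negate = ℤ-solve-∀

≈-trans : ∀ {a b c n} → a ≈ b ⟨mod n ⟩ → b ≈ c ⟨mod n ⟩ → a ≈ c ⟨mod n ⟩
≈-trans {a} {b} {c} (mk≈ n∣a-b) (mk≈ n∣b-c) =
  ≈-from (ℤ∣.∣m∣n⇒∣m+n n∣a-b n∣b-c) (telescope (ℤ.+ a) (ℤ.+ b) (ℤ.+ c))
  where
  telescope : ∀ x y z → (x ℤ.- y) ℤ.+ (y ℤ.- z) ≡ x ℤ.- z
  telescope = ℤ-solve-∀

≈-* : ∀ {a a′ b b′ n} → a ≈ a′ ⟨mod n ⟩ → b ≈ b′ ⟨mod n ⟩ → a * b ≈ a′ * b′ ⟨mod n ⟩
≈-* {a} {a′} {b} {b′} (mk≈ n∣a-a′) (mk≈ n∣b-b′) =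
  ≈-from (ℤ∣.∣m∣n⇒∣m+n (ℤ∣.∣n⇒∣m*n (ℤ.+ a) n∣b-b′) (ℤ∣.∣m⇒∣m*n (ℤ.+ b′) n∣a-a′))
         (trans (split (ℤ.+ a) (ℤ.+ a′) (ℤ.+ b) (ℤ.+ b′))
                (sym (cong₂ ℤ._-_ (ℤP.pos-* a b) (ℤP.pos-* a′ b′))))
  where
  split : ∀ x x′ y y′ → x ℤ.* (y ℤ.- y′) ℤ.+ (x ℤ.- x′) ℤ.* y′ ≡ x ℤ.* y ℤ.- x′ ℤ.* y′
  split = ℤ-solve-∀

≈-^ : ∀ {a b n} k → a ≈ b ⟨mod n ⟩ → a ^ k ≈ b ^ k ⟨mod n ⟩
≈-^ zero    a≈b = ≈-refl 1
≈-^ (suc k) a≈b = ≈-* a≈b (≈-^ k a≈b)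

≈-mod-∣ : ∀ {a b n k} → k ∣ n → a ≈ b ⟨mod n ⟩ → a ≈ b ⟨mod k ⟩
≈-mod-∣ k∣n (mk≈ n∣a-b) = mk≈ (ℤ∣.∣-trans (ℤ∣.∣ᵤ⇒∣ k∣n) n∣a-b)

≈-∣ : ∀ {a b n k} → k ∣ n → a ≈ b ⟨mod n ⟩ → k ∣ a → k ∣ b
≈-∣ {a} {b} k∣n a≈b k∣a with ≈-mod-∣ k∣n a≈b
... | mk≈ k∣a-b = ℤ∣.∣⇒∣ᵤ (subst (_ ℤ∣.∣_) (cancel (ℤ.+ a) (ℤ.+ b))
                                  (ℤ∣.∣m∣n⇒∣m-n (ℤ∣.∣ᵤ⇒∣ {_} {ℤ.+ a} k∣a) k∣a-b))
  where
  cancel : ∀ x y → x ℤ.- (x ℤ.- y) ≡ y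
  cancel = ℤ-solve-∀

∣⇒≈0 : ∀ {a n} → n ∣ a → a ≈ 0 ⟨mod n ⟩
∣⇒≈0 {a} n∣a = ≈-from (ℤ∣.∣ᵤ⇒∣ n∣a) (sym (ℤP.+-identityʳ (ℤ.+ a)))

≈0⇒∣ : ∀ {a n} → a ≈ 0 ⟨mod n ⟩ → n ∣ a
≈0⇒∣ a≈0 = ≈-∣ ∣-refl (≈-sym a≈0) (_ ∣0)

+-multiple-≈ : ∀ n a t → a + n * t ≈ a ⟨mod n ⟩
+-multiple-≈ n a t = ≈-from (ℤ∣.∣n⇒∣m*n (ℤ.+ t) (ℤ∣.∣-refl {ℤ.+ n})) (begin
  ℤ.+ t ℤ.* ℤ.+ n                           ≡⟨ shift (ℤ.+ a) (ℤ.+ n) (ℤ.+ t) ⟩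
  (ℤ.+ a ℤ.+ ℤ.+ n ℤ.* ℤ.+ t) ℤ.- ℤ.+ a     ≡⟨ cong (λ x → ℤ.+ a ℤ.+ x ℤ.- ℤ.+ a) (ℤP.pos-* n t) ⟨
  (ℤ.+ a ℤ.+ ℤ.+ (n * t)) ℤ.- ℤ.+ a         ≡⟨ cong (ℤ._- ℤ.+ a) (ℤP.pos-+ a (n * t)) ⟨
  ℤ.+ (a + n * t) ℤ.- ℤ.+ a                 ∎)
  where
  open ≡-Reasoning
  shift : ∀ x y z → z ℤ.* y ≡ (x ℤ.+ y ℤ.* z) ℤ.- x
  shift = ℤ-solve-∀

%-≈ : ∀ n .{{_ : NonZero n}} a → a % n ≈ a ⟨mod n ⟩
%-≈ n a = ≈-sym (subst (λ x → x ≈ a % n ⟨mod n ⟩) (sym a≡a%n+n*[a/n]) (+-multiple-≈ n (a % n) (a / n)))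
  where
  a≡a%n+n*[a/n] : a ≡ a % n + n * (a / n)
  a≡a%n+n*[a/n] = trans (m≡m%n+[m/n]*n a n) (cong (a % n +_) (*-comm (a / n) n))

≈-cancel : ∀ {a b c n} → Coprime c n → c * a ≈ c * b ⟨mod n ⟩ → a ≈ b ⟨mod n ⟩
≈-cancel {a} {b} {c} {n} c⊥n (mk≈ n∣ca-cb) =
  mk≈ (ℤ∣.∣ᵤ⇒∣ (coprime-divisor (Coprimality.sym c⊥n) n∣c*∣a-b∣))
  where
  factor : ∀ x y z → x ℤ.* y ℤ.- x ℤ.* z ≡ x ℤ.* (y ℤ.- z)
  factor = ℤ-solve-∀
  ca-cb≡c*[a-b] : ℤ.+ (c * a) ℤ.- ℤ.+ (c * b) ≡ ℤ.+ c ℤ.* (ℤ.+ a ℤ.- ℤ.+ b)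
  ca-cb≡c*[a-b] = trans (cong₂ ℤ._-_ (ℤP.pos-* c a) (ℤP.pos-* c b)) (factor (ℤ.+ c) (ℤ.+ a) (ℤ.+ b))
  n∣c*∣a-b∣ : n ∣ c * ℤ.∣ ℤ.+ a ℤ.- ℤ.+ b ∣
  n∣c*∣a-b∣ = subst (n ∣_) (trans (cong ℤ.∣_∣ ca-cb≡c*[a-b]) (ℤP.abs-* (ℤ.+ c) _)) (ℤ∣.∣⇒∣ᵤ n∣ca-cb)

≈-crt : ∀ {a b g h} → Coprime g h → a ≈ b ⟨mod g ⟩ → a ≈ b ⟨mod h ⟩ → a ≈ b ⟨mod g * h ⟩
≈-crt g⊥h (mk≈ g∣a-b) (mk≈ h∣a-b) = mk≈ (ℤ∣.∣ᵤ⇒∣ (coprime-∣-* g⊥h (ℤ∣.∣⇒∣ᵤ g∣a-b) (ℤ∣.∣⇒∣ᵤ h∣a-b)))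

residue-unique : ∀ {a b n} → a < n → b < n → a ≈ b ⟨mod n ⟩ → a ≡ b
residue-unique {a} {b} {n} a<n b<n (mk≈ n∣a-b) =
  ℤP.+-injective (ℤP.i-j≡0⇒i≡j _ _ (ℤP.∣i∣≡0⇒i≡0 (multiple-below-0 ∣a-b∣<n (ℤ∣.∣⇒∣ᵤ n∣a-b))))
  where
  multiple-below-0 : ∀ {x} → x < n → n ∣ x → x ≡ 0
  multiple-below-0 {zero}  _   _   = refl
  multiple-below-0 {suc x} x<n n∣x = ⊥-elim (>⇒∤ x<n n∣x)
  ∣a-b∣<n : ℤ.∣ ℤ.+ a ℤ.- ℤ.+ b ∣ < n
  ∣a-b∣<n = ≤-<-trans (subst (λ x → ℤ.∣ x ∣ ≤ a ⊔ b) (sym (ℤP.m-n≡m⊖n a b)) (ℤP.∣m⊝n∣≤m⊔n a b))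
                      (⊔-lub a<n b<n)

-- An element coprime to n has finite multiplicative order modulo n (pigeonhole on
-- the residues of v⁰, …, vⁿ, then cancel the smaller power).
-- Opaque: callers use only the statement, and unfolding the pigeonhole search
-- (e.g. during with-abstraction) is very expensive.
opaque
  finite-order : ∀ {v n} .{{_ : NonZero n}} → Coprime v n → ∃ λ K → 1 ≤ K × v ^ K ≈ 1 ⟨mod n ⟩
  finite-order {v} {n} v⊥n
    with pigeonhole (n<1+n n) (λ (i : F.Fin (suc n)) → F.fromℕ< (m%n<n (v ^ F.toℕ i) n))
  ... | i , j , i<j , same-residue = K , m<n⇒0<n∸m i<j , ≈-sym (≈-cancel (coprime-^ˡ (F.toℕ i) v⊥n) vⁱ≈vⁱvᴷ)
    where
    K : ℕ
    K = F.toℕ j ∸ F.toℕ i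
    vⁱ%n≡vʲ%n : v ^ F.toℕ i % n ≡ v ^ F.toℕ j % n
    vⁱ%n≡vʲ%n = trans (sym (toℕ-fromℕ< _)) (trans (cong F.toℕ same-residue) (toℕ-fromℕ< _))
    vⁱ≈vʲ : v ^ F.toℕ i ≈ v ^ F.toℕ j ⟨mod n ⟩
    vⁱ≈vʲ = ≈-trans (≈-sym (%-≈ n _)) (subst (λ x → x ≈ v ^ F.toℕ j ⟨mod n ⟩) (sym vⁱ%n≡vʲ%n) (%-≈ n _))
    vʲ≡vⁱvᴷ : v ^ F.toℕ j ≡ v ^ F.toℕ i * v ^ K
    vʲ≡vⁱvᴷ = trans (cong (v ^_) (sym (m+[n∸m]≡n (<⇒≤ i<j)))) (^-distribˡ-+-* v (F.toℕ i) K)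
    vⁱ≈vⁱvᴷ : v ^ F.toℕ i * 1 ≈ v ^ F.toℕ i * v ^ K ⟨mod n ⟩
    vⁱ≈vⁱvᴷ = subst₂ (λ x y → x ≈ y ⟨mod n ⟩) (sym (*-identityʳ _)) vʲ≡vⁱvᴷ vⁱ≈vʲ

≈-prod : ∀ {r a b} (f : Fin r → ℕ) → (∀ i j → i ≢ j → Coprime (f i) (f j)) →
         (∀ i → a ≈ b ⟨mod f i ⟩) → a ≈ b ⟨mod prodFin f ⟩
≈-prod f f-coprime a≈b = ≡[mod]⇒≈ (pairwise-coprime-prod-∣ f f-coprime (λ i → ≈⇒≡[mod] (a≈b i)))

-- The sequential power graph of ℤ/mℤ, for arbitrary m

-- Both ends of an edge are congruent to positive powers of one base a, so a prime
-- divisor of m divides one end exactly when it divides a, i.e. when it divides the other.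
edge-prime-∣ : ∀ {m b c q} → Prime q → q ∣ m → Edge m b c → (q ∣ b → q ∣ c) × (q ∣ c → q ∣ b)
edge-prime-∣ {m} {b} {c} q-prime q∣m (_ , _ , a , suc k , _ , b≡aᵏ⁺¹ , c≡aᵏ⁺²) =
    (λ q∣b → ≈-∣ q∣m (≈-sym c≈aᵏ⁺²)
               (∣m⇒∣m*n (a ^ suc k) (prime-∣-^ {a = a} (suc k) q-prime (≈-∣ q∣m b≈aᵏ⁺¹ q∣b))))
  , (λ q∣c → ≈-∣ q∣m (≈-sym b≈aᵏ⁺¹)
               (∣m⇒∣m*n (a ^ k) (prime-∣-^ {a = a} (suc (suc k)) q-prime (≈-∣ q∣m c≈aᵏ⁺² q∣c))))
  where
  b≈aᵏ⁺¹ : b ≈ a ^ suc k ⟨mod m ⟩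
  b≈aᵏ⁺¹ = ≡[mod]⇒≈ b≡aᵏ⁺¹
  c≈aᵏ⁺² : c ≈ a ^ suc (suc k) ⟨mod m ⟩
  c≈aᵏ⁺² = ≡[mod]⇒≈ c≡aᵏ⁺²

connected-prime-∣ : ∀ {m x z q} → Prime q → q ∣ m → Connected m x z → (q ∣ x → q ∣ z) × (q ∣ z → q ∣ x)
connected-prime-∣ q-prime q∣m (here _) = (λ q∣x → q∣x) , (λ q∣x → q∣x)
connected-prime-∣ q-prime q∣m (fwd xy yz) with edge-prime-∣ q-prime q∣m xy | connected-prime-∣ q-prime q∣m yz
... | x⇒y , y⇒x | y⇒z , z⇒y = (λ q∣x → y⇒z (x⇒y q∣x)) , (λ q∣z → y⇒x (z⇒y q∣z))
connected-prime-∣ q-prime q∣m (bwd yx yz) with edge-prime-∣ q-prime q∣m yx | connected-prime-∣ q-prime q∣m yz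
... | y⇒x , x⇒y | y⇒z , z⇒y = (λ q∣x → y⇒z (x⇒y q∣x)) , (λ q∣z → y⇒x (z⇒y q∣z))

connected-< : ∀ {m x z} → Connected m x z → z < m
connected-< (here z<m)   = z<m
connected-< (fwd _ rest) = connected-< rest
connected-< (bwd _ rest) = connected-< rest

-- Every residue v is joined to the residues of all its positive powers, through the
-- path v ← v² ← … ← vⁿ⁺¹ of edges (vⁱ, vⁱ⁺¹).
power-connected : ∀ {m v} .{{_ : NonZero m}} → v < m → ∀ n → Connected m (v ^ suc n % m) v
power-connected {m} {v} v<m zero =
  subst (λ x → Connected m x v) (sym (trans (cong (_% m) (*-identityʳ v)) (m<n⇒m%n≡m v<m))) (here v<m)
power-connected {m} {v} v<m (suc n) =
  bwd (m%n<n _ m , m%n<n _ m , v , suc n , s≤s z≤n ,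
       ≈⇒≡[mod] (%-≈ m (v ^ suc n)) , ≈⇒≡[mod] (%-≈ m (v ^ suc (suc n))))
      (power-connected v<m n)

-- Every v < m with G ∣ v^N for some N that is a unit modulo H lies in
-- the component of d: if v^K ≡ 1 (mod H), then v^(K(N+1)) ≡ d modulo G and modulo H.
connected-to-idempotent : ∀ {m G H d v} N .{{_ : NonZero m}} .{{_ : NonZero H}} →
  m ≡ G * H → Coprime G H → d < m → G ∣ d → d ≈ 1 ⟨mod H ⟩ →
  v < m → G ∣ v ^ N → Coprime v H → Connected m d v
connected-to-idempotent {m} {G} {H} {d} {v} N m≡GH G⊥H d<m G∣d d≈1 v<m G∣vᴺ v⊥H
  with finite-order v⊥H
... | suc K , _ , vᴷ⁺¹≈1 = subst (λ x → Connected m x v) (sym d≡vᴹ%m) (power-connected v<m (N + K * suc N))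
  where
  M : ℕ
  M = suc K * suc N
  vᴹ≈1 : v ^ M ≈ 1 ⟨mod H ⟩
  vᴹ≈1 = subst₂ (λ x y → x ≈ y ⟨mod H ⟩) (^-*-assoc v (suc K) (suc N)) (^-zeroˡ (suc N)) (≈-^ (suc N) vᴷ⁺¹≈1)
  G∣vᴹ : G ∣ v ^ M
  G∣vᴹ = ∣-trans G∣vᴺ (^-∣-^ʳ v (≤-trans (n≤1+n N) (m≤n*m (suc N) (suc K))))
  vᴹ≈d : v ^ M ≈ d ⟨mod m ⟩
  vᴹ≈d = subst (λ n → v ^ M ≈ d ⟨mod n ⟩) (sym m≡GH)
           (≈-crt G⊥H (≈-trans (∣⇒≈0 G∣vᴹ) (≈-sym (∣⇒≈0 G∣d))) (≈-trans vᴹ≈1 (≈-sym d≈1)))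
  d≡vᴹ%m : d ≡ v ^ M % m
  d≡vᴹ%m = residue-unique d<m (m%n<n _ m) (≈-trans (≈-sym vᴹ≈d) (≈-sym (%-≈ m (v ^ M))))

-- Tails

periodic-power : ∀ {v k n} → v ^ suc k ≈ v ⟨mod n ⟩ → ∀ j → v ^ suc (j * k) ≈ v ⟨mod n ⟩
periodic-power {v} {k} {n} vᵏ⁺¹≈v zero = subst (λ x → x ≈ v ⟨mod n ⟩) (sym (*-identityʳ v)) (≈-refl v)
periodic-power {v} {k} {n} vᵏ⁺¹≈v (suc j) =
  subst (λ x → x ≈ v ⟨mod n ⟩) (sym vᵏ⁺ʲᵏ⁺¹≡vᵏ*vʲᵏ⁺¹)
    (≈-trans (≈-* (≈-refl (v ^ k)) (periodic-power vᵏ⁺¹≈v j))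
             (subst (λ x → x ≈ v ⟨mod n ⟩) (*-comm v (v ^ k)) vᵏ⁺¹≈v))
  where
  vᵏ⁺ʲᵏ⁺¹≡vᵏ*vʲᵏ⁺¹ : v ^ suc (k + j * k) ≡ v ^ k * v ^ suc (j * k)
  vᵏ⁺ʲᵏ⁺¹≡vᵏ*vʲᵏ⁺¹ = trans (cong (v ^_) (sym (+-suc k (j * k)))) (^-distribˡ-+-* v k (suc (j * k)))

-- An element divisible by G and a unit modulo H
-- is not a tail: modulo G all its powers vanish, and modulo H it has finite order K,
-- so v^(K+1) ≡ v modulo both, hence modulo m.
not-tail : ∀ {m G H v} .{{_ : NonZero H}} → m ≡ G * H → Coprime G H →
           G ∣ v → Coprime v H → ¬ IsTail m v
not-tail {m} {G} {H} {v} m≡GH G⊥H G∣v v⊥H v-tail with finite-order v⊥H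
... | K , K≥1 , vᴷ≈1 =
  v-tail K K≥1 (≈⇒≡[mod] (subst (λ n → v ^ suc K ≈ v ⟨mod n ⟩) (sym m≡GH) (≈-crt G⊥H modG modH)))
  where
  modG : v ^ suc K ≈ v ⟨mod G ⟩
  modG = ≈-trans (∣⇒≈0 (∣m⇒∣m*n (v ^ K) G∣v)) (≈-sym (∣⇒≈0 G∣v))
  modH : v ^ suc K ≈ v ⟨mod H ⟩
  modH = subst (λ x → v ^ suc K ≈ x ⟨mod H ⟩) (*-identityʳ v) (≈-* (≈-refl v) vᴷ≈1)

-- For a divisor k of m, k divides an element of y π U exactly when it divides y π,
-- because the two differ by a unit modulo m.
coset-∣⇒ : ∀ {m v k} y π → InCoset m y π v → k ∣ m → k ∣ v → k ∣ y * π
coset-∣⇒ {k = k} y π (_ , u , _ , u⊥m , v≡yπu) k∣m k∣v =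
  coprime-divisor (coprime-∣ˡ k∣m (Coprimality.sym u⊥m))
    (subst (k ∣_) (*-comm (y * π) u) (≈-∣ k∣m (≡[mod]⇒≈ v≡yπu) k∣v))

coset-∣⇐ : ∀ {m v k} y π → InCoset m y π v → k ∣ m → k ∣ y * π → k ∣ v
coset-∣⇐ y π (_ , u , _ , _ , v≡yπu) k∣m k∣yπ = ≈-∣ k∣m (≈-sym (≡[mod]⇒≈ v≡yπu)) (∣m⇒∣m*n u k∣yπ)

-- Every coset y π U is nonempty: it contains (y π) mod m, taking the unit 1 mod m.
coset-nonempty : ∀ {m} .{{_ : NonZero m}} y π → ∃ λ v → InCoset m y π v
coset-nonempty {m} y π = (y * π) % m , m%n<n _ m , 1 % m , m%n<n 1 m , 1%m⊥m , ≈⇒≡[mod] yπ%m≈yπ[1%m]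
  where
  1%m⊥m : Coprime (1 % m) m
  1%m⊥m (k∣1%m , k∣m) = ∣1⇒≡1 (∣n∣m%n⇒∣m k∣m k∣1%m)
  yπ%m≈yπ[1%m] : (y * π) % m ≈ y * π * (1 % m) ⟨mod m ⟩
  yπ%m≈yπ[1%m] = ≈-trans (%-≈ m (y * π))
    (subst (λ x → x ≈ y * π * (1 % m) ⟨mod m ⟩) (*-identityʳ (y * π)) (≈-* (≈-refl (y * π)) (≈-sym (%-≈ m 1))))

cofactor-shift : ∀ {m w M′} .{{_ : NonZero m}} → m ≡ w * M′ → ∀ a t → w * ((a + M′ * t) % m) ≈ w * a ⟨mod m ⟩
cofactor-shift {m} {w} {M′} m≡wM′ a t =
  ≈-trans (≈-* (≈-refl w) (%-≈ m (a + M′ * t)))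
          (subst (λ x → x ≈ w * a ⟨mod m ⟩) (sym w[a+M′t]≡wa+mt) (+-multiple-≈ m (w * a) t))
  where
  w[a+M′t]≡wa+mt : w * (a + M′ * t) ≡ w * a + m * t
  w[a+M′t]≡wa+mt = trans (*-distribˡ-+ w a (M′ * t))
                         (cong (w * a +_) (trans (sym (*-assoc w M′ t)) (cong (_* t) (sym m≡wM′))))

module DistinctPrimes {r : ℕ} (p : Fin r → ℕ) (p-prime : ∀ i → Prime (p i))
                      (p-injective : Injective _≡_ _≡_ p) where

  PrimePowers : (Fin r → ℕ) → Set
  PrimePowers f = ∀ i → ∃ λ k → f i ≡ p i ^ k

  prime-powers-coprime₂ : ∀ {f g} → PrimePowers f → PrimePowers g → ∀ i j → i ≢ j → Coprime (f i) (g j)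
  prime-powers-coprime₂ f-powers g-powers i j i≢j with f-powers i | g-powers j
  ... | k , fᵢ≡pᵢᵏ | l , gⱼ≡pⱼˡ =
    subst₂ Coprime (sym fᵢ≡pᵢᵏ) (sym gⱼ≡pⱼˡ)
      (distinct-prime-powers-coprime k l (p-prime i) (p-prime j) (λ pᵢ≡pⱼ → i≢j (p-injective pᵢ≡pⱼ)))

  prime-powers-coprime : ∀ {f} → PrimePowers f → ∀ i j → i ≢ j → Coprime (f i) (f j)
  prime-powers-coprime f-powers = prime-powers-coprime₂ f-powers f-powers

  prime-powers>0 : ∀ {f} → PrimePowers f → ∀ i → 0 < f i
  prime-powers>0 f-powers i with f-powers i
  ... | k , fᵢ≡pᵢᵏ = subst (0 <_) (sym fᵢ≡pᵢᵏ) (m^n>0 (p i) {{prime⇒nonZero (p-prime i)}} k)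

  coprime-to-primes : ∀ {x} (e : Fin r → ℕ) → (∀ i → ¬ p i ∣ x) → Coprime x (prodFin (λ i → p i ^ e i))
  coprime-to-primes e pᵢ∤x =
    coprime-prod _ (λ i → Coprimality.sym (coprime-^ˡ (e i) (prime-coprime (p-prime i) (pᵢ∤x i))))

  primesNotDividing : ℕ → Fin r → ℕ
  primesNotDividing a i with p i ∣? a
  ... | yes _ = 1
  ... | no  _ = p i

  nondivisor-∣-primesNotDividing : ∀ {a} i → ¬ p i ∣ a → p i ∣ primesNotDividing a i
  nondivisor-∣-primesNotDividing {a} i pᵢ∤a with p i ∣? a
  ... | yes pᵢ∣a = ⊥-elim (pᵢ∤a pᵢ∣a)
  ... | no  _    = ∣-refl

  ∣-primesNotDividing⇒∤ : ∀ {a} i j → p i ∣ primesNotDividing a j → ¬ p i ∣ a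
  ∣-primesNotDividing⇒∤ {a} i j pᵢ∣factor with p j ∣? a
  ... | yes _   = ⊥-elim (prime∤1 (p-prime i) pᵢ∣factor)
  ... | no pⱼ∤a with p-injective (prime-∣-prime (p-prime i) (p-prime j) pᵢ∣factor)
  ...   | refl = pⱼ∤a

  -- If a is coprime to M, then a + M t is divisible by no pᵢ, for t the product of
  -- the pᵢ not dividing a.
  -- (A pᵢ dividing a misses both M and t; a pᵢ not dividing a divides M t.)
  avoid-primes : ∀ a M → Coprime a M → ∃ λ t → ∀ i → ¬ p i ∣ a + M * t
  avoid-primes a M a⊥M = t , pᵢ∤a+Mt
    where
    t : ℕ
    t = prodFin (primesNotDividing a)
    pᵢ∤a+Mt : ∀ i → ¬ p i ∣ a + M * t
    pᵢ∤a+Mt i pᵢ∣a+Mt with p i ∣? a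
    ... | no pᵢ∤a = pᵢ∤a (∣m+n∣m⇒∣n (subst (p i ∣_) (+-comm a (M * t)) pᵢ∣a+Mt)
                                     (∣n⇒∣m*n M (∣-trans (nondivisor-∣-primesNotDividing i pᵢ∤a)
                                                          (factor-∣-prod (primesNotDividing a) i))))
    ... | yes pᵢ∣a with euclidsLemma M t (p-prime i) (∣m+n∣m⇒∣n pᵢ∣a+Mt pᵢ∣a)
    ...   | inj₁ pᵢ∣M = prime∤1 (p-prime i) (subst (p i ∣_) (a⊥M (pᵢ∣a , pᵢ∣M)) ∣-refl)
    ...   | inj₂ pᵢ∣t = let (j , pᵢ∣factor) = prime-∣-prod (primesNotDividing a) (p-prime i) pᵢ∣t
                        in ∣-primesNotDividing⇒∤ i j pᵢ∣factor pᵢ∣a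

  -- Let m = ∏ pᵢ^eᵢ = w M′. If w ∣ v and v / w is coprime to M′, then v = w u for a
  -- unit u modulo m: shift v / w by a multiple of M′ to avoid every pᵢ.
  unit-multiple : ∀ {m w M′ v} (e : Fin r → ℕ) .{{_ : NonZero m}} .{{_ : NonZero w}} →
                  m ≡ prodFin (λ i → p i ^ e i) → m ≡ w * M′ → w ∣ v → Coprime (v / w) M′ →
                  ∃ λ u → u < m × Coprime u m × w * u ≈ v ⟨mod m ⟩
  unit-multiple {m} {w} {M′} {v} e m≡∏pᵉ m≡wM′ w∣v v/w⊥M′ with avoid-primes (v / w) M′ v/w⊥M′
  ... | t , pᵢ∤u₀ = u₀ % m , m%n<n u₀ m , u⊥m ,
                    subst (λ x → w * (u₀ % m) ≈ x ⟨mod m ⟩) (m*[n/m]≡n w∣v)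
                          (cofactor-shift {w = w} {M′} m≡wM′ (v / w) t)
    where
    u₀ : ℕ
    u₀ = v / w + M′ * t
    u₀⊥m : Coprime u₀ m
    u₀⊥m = subst (Coprime u₀) (sym m≡∏pᵉ) (coprime-to-primes e pᵢ∤u₀)
    u⊥m : Coprime (u₀ % m) m
    u⊥m (k∣u , k∣m) = u₀⊥m (∣n∣m%n⇒∣m k∣m k∣u , k∣m)

module Setting (m r : ℕ) (p e : Fin r → ℕ) (p-prime : ∀ i → Prime (p i))
               (p-injective : Injective _≡_ _≡_ p) (e≥1 : ∀ i → 1 ≤ e i)
               (m≡∏pᵉ : m ≡ prodFin (λ i → p i ^ e i))
               (I : Subset r) (d : ℕ) (d-idempotent : IsDI m p e I d) where

  open DistinctPrimes p p-prime p-injective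

  true⇒∈ : ∀ {i} → lookup I i ≡ true → i ∈ I
  true⇒∈ {i} = lookup⇒[]= i I

  false⇒∉ : ∀ {i} → lookup I i ≡ false → i ∉ I
  false⇒∉ Iᵢ≡false i∈I with trans (sym ([]=⇒lookup i∈I)) Iᵢ≡false
  ... | ()

  Gᶠ Hᶠ πᶠ hᶠ : Fin r → ℕ
  Gᶠ i = if lookup I i then p i ^ e i else 1
  Hᶠ i = if lookup I i then 1 else p i ^ e i
  πᶠ i = if lookup I i then p i else 1
  hᶠ i = if lookup I i then p i ^ (e i ∸ 1) else 1

  G H π h : ℕ
  G = gI p e I
  H = prodFin Hᶠ
  π = πI p I
  h = gOverπ p e I

  Gᶠ-powers : PrimePowers Gᶠ
  Gᶠ-powers i with lookup I i
  ... | true  = e i , refl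
  ... | false = 0 , refl

  Hᶠ-powers : PrimePowers Hᶠ
  Hᶠ-powers i with lookup I i
  ... | true  = 0 , refl
  ... | false = e i , refl

  πᶠ-powers : PrimePowers πᶠ
  πᶠ-powers i with lookup I i
  ... | true  = 1 , sym (*-identityʳ (p i))
  ... | false = 0 , refl

  m≡G*H : m ≡ G * H
  m≡G*H = trans m≡∏pᵉ (trans (prod-cong pᵉ≡Gᶠ*Hᶠ) (prod-* Gᶠ Hᶠ))
    where
    pᵉ≡Gᶠ*Hᶠ : ∀ i → p i ^ e i ≡ Gᶠ i * Hᶠ i
    pᵉ≡Gᶠ*Hᶠ i with lookup I i
    ... | true  = sym (*-identityʳ _)
    ... | false = sym (+-identityʳ _)

  G≡π*h : G ≡ π * h
  G≡π*h = trans (prod-cong Gᶠ≡πᶠ*hᶠ) (prod-* πᶠ hᶠ)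
    where
    Gᶠ≡πᶠ*hᶠ : ∀ i → Gᶠ i ≡ πᶠ i * hᶠ i
    Gᶠ≡πᶠ*hᶠ i with lookup I i | e i | e≥1 i
    ... | true  | suc k | _ = refl
    ... | false | _     | _ = refl

  G⊥H : Coprime G H
  G⊥H = prod-coprime-prod Gᶠ Hᶠ Gᵢ⊥Hⱼ
    where
    Gᵢ⊥Hⱼ : ∀ i j → Coprime (Gᶠ i) (Hᶠ j)
    Gᵢ⊥Hⱼ i j with i F.≟ j
    ... | no i≢j = prime-powers-coprime₂ Gᶠ-powers Hᶠ-powers i j i≢j
    Gᵢ⊥Hⱼ i .i | yes refl with lookup I i
    ... | true  = Coprimality.sym (1-coprimeTo _)
    ... | false = 1-coprimeTo _

  instance
    G≢0 : NonZero G
    G≢0 = >-nonZero (prod>0 Gᶠ (prime-powers>0 Gᶠ-powers))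
    H≢0 : NonZero H
    H≢0 = >-nonZero (prod>0 Hᶠ (prime-powers>0 Hᶠ-powers))
    π≢0 : NonZero π
    π≢0 = >-nonZero (prod>0 πᶠ (prime-powers>0 πᶠ-powers))
    m≢0 : NonZero m
    m≢0 = >-nonZero (subst (0 <_) (sym m≡G*H) (*-mono-< (>-nonZero⁻¹ G) (>-nonZero⁻¹ H)))

  G∣m : G ∣ m
  G∣m = divides H (trans m≡G*H (*-comm G H))

  H∣m : H ∣ m
  H∣m = divides G m≡G*H

  p∣pᵉ : ∀ i → p i ∣ p i ^ e i
  p∣pᵉ i with e i | e≥1 i
  ... | suc k | _ = m∣m*n _

  p∣m : ∀ i → p i ∣ m
  p∣m i = subst (p i ∣_) (sym m≡∏pᵉ) (∣-trans (p∣pᵉ i) (factor-∣-prod (λ j → p j ^ e j) i))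

  -- G divides a high power of every multiple of π: pᵢ^eᵢ ∣ pᵢ^N for N = ∏ eᵢ.
  N : ℕ
  N = prodFin e

  G∣ᴺ : ∀ {v} → π ∣ v → G ∣ v ^ N
  G∣ᴺ {v} π∣v = pairwise-coprime-prod-∣ Gᶠ (prime-powers-coprime Gᶠ-powers)
                  (λ i → Gᶠ∣vᴺ i (∣-trans (factor-∣-prod πᶠ i) π∣v))
    where
    eᵢ≤N : ∀ i → e i ≤ N
    eᵢ≤N i = ∣⇒≤ {{>-nonZero (prod>0 e e≥1)}} (factor-∣-prod e i)
    Gᶠ∣vᴺ : ∀ i → πᶠ i ∣ v → Gᶠ i ∣ v ^ N
    Gᶠ∣vᴺ i πᵢ∣v with lookup I i
    ... | true  = ∣-trans (^-∣-^ʳ (p i) (eᵢ≤N i)) (^-∣-^ˡ N πᵢ∣v)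
    ... | false = 1∣ _

  d≈0-mod-pᵉ : ∀ {i} → i ∈ I → d ≈ 0 ⟨mod p i ^ e i ⟩
  d≈0-mod-pᵉ {i} i∈I = ≡[mod]⇒≈ (proj₁ (proj₂ d-idempotent i) i∈I)

  d≈1-mod-pᵉ : ∀ {i} → i ∉ I → d ≈ 1 ⟨mod p i ^ e i ⟩
  d≈1-mod-pᵉ {i} i∉I = ≡[mod]⇒≈ (proj₂ (proj₂ d-idempotent i) i∉I)

  G∣d : G ∣ d
  G∣d = ≈0⇒∣ (≈-prod Gᶠ (prime-powers-coprime Gᶠ-powers) d≈0-mod-Gᶠ)
    where
    d≈0-mod-Gᶠ : ∀ i → d ≈ 0 ⟨mod Gᶠ i ⟩
    d≈0-mod-Gᶠ i with lookup I i in Iᵢ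
    ... | true  = d≈0-mod-pᵉ (true⇒∈ Iᵢ)
    ... | false = ≡[mod]⇒≈ (1∣ _)

  d≈1-mod-H : d ≈ 1 ⟨mod H ⟩
  d≈1-mod-H = ≈-prod Hᶠ (prime-powers-coprime Hᶠ-powers) d≈1-mod-Hᶠ
    where
    d≈1-mod-Hᶠ : ∀ i → d ≈ 1 ⟨mod Hᶠ i ⟩
    d≈1-mod-Hᶠ i with lookup I i in Iᵢ
    ... | true  = ≡[mod]⇒≈ (1∣ _)
    ... | false = d≈1-mod-pᵉ (false⇒∉ Iᵢ)

  pᵢ∣d : ∀ {i} → i ∈ I → p i ∣ d
  pᵢ∣d {i} i∈I = ∣-trans (p∣pᵉ i) (≈0⇒∣ (d≈0-mod-pᵉ i∈I))

  pᵢ∤d : ∀ {i} → i ∉ I → ¬ p i ∣ d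
  pᵢ∤d {i} i∉I pᵢ∣d = prime∤1 (p-prime i) (≈-∣ (p∣pᵉ i) (d≈1-mod-pᵉ i∉I) pᵢ∣d)

  -- The component of d: divisibility by each pᵢ is constant on it, so its elements
  -- are multiples of π and units modulo H.
  component-π∣ : ∀ {v} → Connected m d v → π ∣ v
  component-π∣ {v} d~v = pairwise-coprime-prod-∣ πᶠ (prime-powers-coprime πᶠ-powers) πᶠ∣v
    where
    πᶠ∣v : ∀ i → πᶠ i ∣ v
    πᶠ∣v i with lookup I i in Iᵢ
    ... | true  = proj₁ (connected-prime-∣ (p-prime i) (p∣m i) d~v) (pᵢ∣d (true⇒∈ Iᵢ))
    ... | false = 1∣ v

  component-⊥H : ∀ {v} → Connected m d v → Coprime v H
  component-⊥H {v} d~v = coprime-prod Hᶠ v⊥Hᶠ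
    where
    v⊥Hᶠ : ∀ i → Coprime v (Hᶠ i)
    v⊥Hᶠ i with lookup I i in Iᵢ
    ... | true  = Coprimality.sym (1-coprimeTo v)
    ... | false = Coprimality.sym (coprime-^ˡ (e i) (prime-coprime (p-prime i)
                    (λ pᵢ∣v → pᵢ∤d (false⇒∉ Iᵢ) (proj₂ (connected-prime-∣ (p-prime i) (p∣m i) d~v) pᵢ∣v))))

  π∣G : π ∣ G
  π∣G = divides h (trans G≡π*h (*-comm π h))

  coset-π∣ : ∀ {v} y → InCoset m y π v → π ∣ v
  coset-π∣ y v∈yπU = coset-∣⇐ y π v∈yπU (∣-trans π∣G G∣m) (n∣m*n y)

  yπ∣G : ∀ {y} → y ∣ h → y * π ∣ G
  yπ∣G {y} y∣h = subst (y * π ∣_) (trans (*-comm h π) (sym G≡π*h)) (*-monoˡ-∣ π y∣h)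

  yπ∣m : ∀ {y} → y ∣ h → y * π ∣ m
  yπ∣m y∣h = ∣-trans (yπ∣G y∣h) G∣m

  -- Distinct divisors y of h give disjoint cosets: a common element v is divisible
  -- by exactly the same divisors of m as y π and as y′ π, so these divide each other.
  cosets-disjoint : ∀ {y y′ v} → y ∣ h → y′ ∣ h → InCoset m y π v → InCoset m y′ π v → y ≡ y′
  cosets-disjoint {y} {y′} y∣h y′∣h v∈yπU v∈y′πU =
    *-cancelʳ-≡ y y′ π (∣-antisym (coset-∣⇒ y′ π v∈y′πU (yπ∣m y∣h) (coset-∣⇐ y π v∈yπU (yπ∣m y∣h) ∣-refl))
                                  (coset-∣⇒ y π v∈yπU (yπ∣m y′∣h) (coset-∣⇐ y′ π v∈y′πU (yπ∣m y′∣h) ∣-refl)))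

  -- Every element of y π U (y ∣ h) is a multiple of π and a unit modulo H, hence
  -- lies in the component of d.
  coset-connected : ∀ {y v} → y ∣ h → InCoset m y π v → Connected m d v
  coset-connected {y} {v} y∣h v∈yπU =
    connected-to-idempotent N m≡G*H G⊥H (proj₁ d-idempotent) G∣d d≈1-mod-H
      (proj₁ v∈yπU) (G∣ᴺ (coset-π∣ y v∈yπU)) v⊥H
    where
    v⊥H : Coprime v H
    v⊥H (k∣v , k∣H) = G⊥H (∣-trans (coset-∣⇒ y π v∈yπU (∣-trans k∣H H∣m) k∣v) (yπ∣G y∣h) , k∣H)

  -- For y a proper divisor of h, the elements of y π U are tails: if v^(k+1) ≡ v, then
  -- v ≡ v^(Nk+1), which is divisible by G; so G ∣ y π, i.e. h ∣ y.
  coset-tail : ∀ {y v} → y ∣ h → y ≢ h → InCoset m y π v → IsTail m v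
  coset-tail {y} {v} y∣h y≢h v∈yπU k k≥1 vᵏ⁺¹≡v = y≢h (∣-antisym y∣h h∣y)
    where
    G∣v : G ∣ v
    G∣v = ≈-∣ G∣m (periodic-power (≡[mod]⇒≈ vᵏ⁺¹≡v) N)
            (∣-trans (G∣ᴺ (coset-π∣ y v∈yπU)) (^-∣-^ʳ v (m≤n⇒m≤1+n (m≤m*n N k {{>-nonZero k≥1}}))))
    h∣y : h ∣ y
    h∣y = *-cancelʳ-∣ π (subst (_∣ y * π) (trans G≡π*h (*-comm π h)) (coset-∣⇒ y π v∈yπU G∣m G∣v))

  -- Every v in the component of d is gcd(v, G) times a unit modulo m: with w = gcd(v, G),
  -- v / w is coprime to G / w and (as v is) to H, and m = w · (G / w) · H.
  component-gcd-unit : ∀ {v} → Connected m d v → ∃ λ u → u < m × Coprime u m × gcd v G * u ≈ v ⟨mod m ⟩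
  component-gcd-unit {v} d~v =
    unit-multiple {w = w} e m≡∏pᵉ m≡w*[G/w*H] (gcd[m,n]∣m v G) v/w⊥G/w*H
    where
    w : ℕ
    w = gcd v G
    instance
      w≢0 : NonZero w
      w≢0 = ≢-nonZero (gcd[m,n]≢0 v G (inj₂ (≢-nonZero⁻¹ G)))
    m≡w*[G/w*H] : m ≡ w * (G / w * H)
    m≡w*[G/w*H] = trans m≡G*H (trans (cong (_* H) (trans (sym (m/n*n≡m (gcd[m,n]∣n v G))) (*-comm (G / w) w)))
                                     (*-assoc w (G / w) H))
    v/w⊥G/w*H : Coprime (v / w) (G / w * H)
    v/w⊥G/w*H = coprime-*ʳ (coprime-/gcd v G)
                  (coprime-∣ˡ (divides w (sym (m*[n/m]≡n (gcd[m,n]∣m v G)))) (component-⊥H d~v))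

  -- Conversely, a tail v of the component of d lies in y π U where gcd(v, G) = y π
  -- (π divides both v and G): y ∣ h since gcd(v, G) ∣ G, and y ≠ h since otherwise
  -- G ∣ v and v would not be a tail.
  tail-in-coset : ∀ {v} → Connected m d v → IsTail m v →
                  ∃ λ y → (y ∣ h × y ≢ h) × InCoset m y π v
  tail-in-coset {v} d~v v-tail =
    let (u , u<m , u⊥m , wu≈v) = component-gcd-unit d~v
    in y , (y∣h , y≢h) , connected-< d~v , u , u<m , u⊥m ,
       ≈⇒≡[mod] (subst (λ x → v ≈ x * u ⟨mod m ⟩) w≡yπ (≈-sym wu≈v))
    where
    π∣w : π ∣ gcd v G
    π∣w = gcd-greatest (component-π∣ d~v) π∣G
    y : ℕ
    y = quotient π∣w
    w≡yπ : gcd v G ≡ y * π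
    w≡yπ = _∣_.equality π∣w
    y∣h : y ∣ h
    y∣h = *-cancelʳ-∣ π (subst₂ _∣_ w≡yπ (trans G≡π*h (*-comm π h)) (gcd[m,n]∣n v G))
    y≢h : y ≢ h
    y≢h y≡h = not-tail m≡G*H G⊥H (subst (_∣ v) w≡G (gcd[m,n]∣m v G)) (component-⊥H d~v) v-tail
      where
      w≡G : gcd v G ≡ G
      w≡G = trans w≡yπ (trans (cong (_* π) y≡h) (trans (*-comm h π) (sym G≡π*h)))
-- Theorem: the cosets y π_I U, for the proper divisors y of g_I / π_I, partition the
-- tails of the component of d_I. (The argument does not need ∅ ≠ I ≠ R.)

mainTheorem12 : (m r : ℕ) (p e : Fin r → ℕ) →
  (∀ i → Prime (p i)) → Injective _≡_ _≡_ p → (∀ i → 1 ≤ e i) →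
  m ≡ prodFin (λ i → p i ^ e i) →
  (I : Subset r) → ∃ (λ i → i ∈ I) → ∃ (λ j → j ∉ I) →
  (d : ℕ) → IsDI m p e I d →
  let C = λ v → Connected m d v
      T = λ v → C v × IsTail m v
      D = λ y → y ∣ gOverπ p e I × y ≢ gOverπ p e I
  in
    -- every block is nonempty
    (∀ y → D y → ∃ (λ v → InCoset m y (πI p I) v))
    -- blocks for distinct y are disjoint
    × (∀ y y′ → D y → D y′ → y ≢ y′ →
         ∀ v → InCoset m y (πI p I) v → ¬ InCoset m y′ (πI p I) v)
    -- the union of the blocks is exactly the set of tails of C_I
    × (∀ v → T v → ∃ (λ y → D y × InCoset m y (πI p I) v))
    × (∀ v y → D y → InCoset m y (πI p I) v → T v)
mainTheorem12 m r p e p-prime p-injective e≥1 m≡∏pᵉ I _ _ d d-idempotent =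
    (λ y _ → coset-nonempty y π)
  , (λ y y′ (y∣h , _) (y′∣h , _) y≢y′ v v∈yπU v∈y′πU → y≢y′ (cosets-disjoint y∣h y′∣h v∈yπU v∈y′πU))
  , (λ v (d~v , v-tail) → tail-in-coset d~v v-tail)
  , (λ v y (y∣h , y≢h) v∈yπU → coset-connected y∣h v∈yπU , coset-tail y∣h y≢h v∈yπU)
  where open Setting m r p e p-prime p-injective e≥1 m≡∏pᵉ I d d-idempotent
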